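{- Let $h \geq 2$, and let $X$ be a finite $B_{2h-1,h-1}$-set contained in an abelian group $\Gamma$. Then all maximal $B_h$-subsets of $X$ have the same cardinality.
   Context: For a subset $A$ of an abelian group and integers $1 \leq k \leq h$, $A$ is a $B_{h,k}$-set if whenever $a_1,\ldots,a_h,a'_1,\ldots,a'_h \in A$ satisfy $a_1+\cdots+a_h = a'_1+\cdots+a'_h$, there exist sets $I, I' \subseteq \{1,\ldots,h\}$ with $|I|=|I'|=k$ and a bijection $\tau: I' \to I$ such that $a'_{i'} = a_{\tau(i')}$ for all $i' \in I'$. A $B_h$-set (Sidon set of order $h$) is a $B_{h,h}$-set. A maximal $B_h$-subset of $X$ is a $B_h$-set contained in $X$ that is not properly contained in any $B_h$-subset of $X$. -}

module Defs where

open import Level using (Level; _⊔_)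
open import Data.Nat using (ℕ)
open import Data.Fin using (Fin)
open import Data.Fin.Subset using (Subset; _∈_; _⊆_; ∣_∣)
open import Data.Product using (Σ; ∃; _×_)
open import Relation.Binary.PropositionalEquality using (_≡_)
open import Relation.Unary using (Pred)
open import Function.Definitions using (Injective)
open import Algebra.Bundles using (AbelianGroup)
import Algebra.Definitions.RawMonoid as RM

module _ {c ℓ : Level} (Γ : AbelianGroup c ℓ) where
  open AbelianGroup Γ

  ΣΓ : ∀ {n} → (Fin n → Carrier) → Carrier
  ΣΓ = RM.sum rawMonoid

  -- A is a B_{h,k}-set: whenever a₁+⋯+a_h = a'₁+⋯+a'_h with all aᵢ, a'ᵢ ∈ A,
  -- there are index sets I, I' ⊆ {1..h} of size k and a bijection τ : I' → I
  -- with a'_{i'} = a_{τ(i')}.  The k-element sets I, I' and τ are encoded by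
  -- injective enumerations σ, σ' : Fin k → Fin h (I = im σ, I' = im σ',
  -- τ = σ ∘ σ'⁻¹), with a'_{σ' j} = a_{σ j} for all j.
  IsBhk : ∀ {p} → ℕ → ℕ → Pred Carrier p → Set (c ⊔ ℓ ⊔ p)
  IsBhk h k A =
    (a a' : Fin h → Carrier) →
    (∀ i → A (a i)) → (∀ i → A (a' i)) →
    ΣΓ a ≈ ΣΓ a' →
    Σ (Fin k → Fin h) λ σ → Σ (Fin k → Fin h) λ σ' →
      Injective _≡_ _≡_ σ × Injective _≡_ _≡_ σ' ×
      (∀ j → a' (σ' j) ≈ a (σ j))

  IsBh : ∀ {p} → ℕ → Pred Carrier p → Set (c ⊔ ℓ ⊔ p)
  IsBh h A = IsBhk h h A

  -- The finite set X = {x₀, …, x_{n-1}} ⊆ Γ is given by an injective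
  -- enumeration x : Fin n → Carrier; its subsets are the images of S ⊆ Fin n.
  Img : ∀ {n} → (Fin n → Carrier) → Subset n → Pred Carrier ℓ
  Img x S g = ∃ λ i → i ∈ S × g ≈ x i

  IsMaximalBhSubset : ∀ {n} → ℕ → (Fin n → Carrier) → Subset n → Set (c ⊔ ℓ)
  IsMaximalBhSubset h x S =
    IsBh h (Img x S) ×
    (∀ T → S ⊆ T → IsBh h (Img x T) → T ⊆ S)

{-# OPTIONS --safe #-}
-- A relation among the elements x₀, …, xₙ₋₁ of X is an integer vector r with Σ rᵢ = 0 and
-- Σ rᵢ xᵢ = 0; its weight is the sum of its positive entries. A subset J of X is a B_h-set
-- exactly when no nonzero relation of weight at most h is supported on J. Padding a relation
-- of weight m with 2h - 1 - m copies of an element at which it is negative and applying the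
-- B_{2h-1,h-1} property shows that X has no nonzero relation of weight strictly between h and
-- 2h. So the difference of two short relations that are positive at X is again short or zero,
-- and the subtractive Euclidean algorithm on their coefficients at X eliminates X. This
-- circuit elimination makes the B_h-subsets of X the independent sets of a matroid, whose
-- maximal independent sets all have the same size.
module Submission where

open import Level using (Level; _⊔_)
open import Algebra.Bundles using (AbelianGroup)
import Algebra.Definitions.RawMonoid as RawMonoidDefinitions
import Algebra.Properties.CommutativeMonoid.Sum as CommutativeMonoidSum
import Algebra.Properties.Group as GroupProperties
import Algebra.Properties.Monoid.Mult as MonoidMult
open import Data.Bool using (true)
open import Data.Empty using (⊥-elim)
open import Data.Fin as Fin using (Fin; zero; suc; splitAt)
import Data.Fin.Properties as FinP
open import Data.Fin.Subset
  using (Subset; inside; outside; _∈_; _∉_; _⊆_; _⊈_; _∪_; _─_; _-_; ⁅_⁆; ⊤; ∣_∣; Empty)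
open import Data.Fin.Subset.Properties
  using (_∈?_; nonempty?; ∈⊤; x∈⁅x⁆; x∈⁅y⁆⇒x≡y; p⊆p∪q; q⊆p∪q; x∈p∪q⁻; x∈p∪q⁺; p─⊥≡p; p─q⊆p;
         x∈p∧x∉q⇒x∈p─q; x∈p∧x≢y⇒x∈p-y; p⊆q⇒∣p∣≤∣q∣; p⊂q⇒∣p∣<∣q∣)
open import Data.Integer as ℤ using (ℤ; +_; -[1+_]; _⊖_; 0ℤ)
import Data.Integer.Properties as ℤP
open import Data.Integer.Tactic.RingSolver using (solve-∀)
open import Data.Nat as ℕ using (ℕ; zero; suc; _+_; _*_; _∸_; _≤_; _<_; z≤n; s≤s)
open import Data.Nat.Induction using (<-wellFounded)
import Data.Nat.Properties as ℕP
open import Data.Product using (Σ; ∃; _×_; _,_; proj₁; proj₂)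
open import Data.Sum using (_⊎_; inj₁; inj₂; [_,_]′)
open import Data.Sum.Properties using ([,]-∘; [,]-map)
import Data.Vec as Vec
open import Data.Vec using (_∷_; here; there)
open import Data.Vec.Functional using (_++_; replicate)
import Data.Vec.Properties as VecP
open import Function using (_∘_; id)
open import Function.Definitions using (Injective)
open import Induction.WellFounded using (Acc; acc)
open import Relation.Binary.Definitions using (tri<; tri≈; tri>)
open import Relation.Binary.PropositionalEquality
  using (_≡_; _≢_; refl; sym; trans; cong; cong₂; subst; module ≡-Reasoning)
import Relation.Binary.Reasoning.Setoid as SetoidReasoning
open import Relation.Nullary using (¬_; yes; no)
open import Relation.Nullary.Decidable using (decidable-stable; isNo)
open import Relation.Unary using (Pred)
open import Algebra.Properties.CommutativeMonoid.Sum ℕP.+-0-commutativeMonoid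
  using (sum; sum-cong-≗; sum-remove; sum-replicate-zero; ∑-distrib-+)

open import Defs

private
  variable
    n : ℕ

x∈p─q⇒x∉q : ∀ {x : Fin n} (p q : Subset n) → x ∈ p ─ q → x ∉ q
x∈p─q⇒x∉q (inside ∷ p) (outside ∷ q) here ()
x∈p─q⇒x∉q (_ ∷ p) (_ ∷ q) (there x∈p─q) (there x∈q) = x∈p─q⇒x∉q p q x∈p─q x∈q

x∉p-x : ∀ (p : Subset n) x → x ∉ p - x
x∉p-x p x x∈p-x = x∈p─q⇒x∉q p ⁅ x ⁆ x∈p-x (x∈⁅x⁆ x)

Empty[p─q]⇒p⊆q : ∀ {p q : Subset n} → Empty (p ─ q) → p ⊆ q
Empty[p─q]⇒p⊆q {q = q} p─q-empty {x} x∈p =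
  decidable-stable (x ∈? q) λ x∉q → p─q-empty (x , x∈p∧x∉q⇒x∈p─q x∈p x∉q)

∪-least : ∀ {p q r : Subset n} → p ⊆ r → q ⊆ r → p ∪ q ⊆ r
∪-least {p = p} {q = q} p⊆r q⊆r = [ p⊆r , q⊆r ]′ ∘ x∈p∪q⁻ p q

p⊆q∪⁅x⁆∧x∉p⇒p⊆q : ∀ {p q : Subset n} {x} → p ⊆ q ∪ ⁅ x ⁆ → x ∉ p → p ⊆ q
p⊆q∪⁅x⁆∧x∉p⇒p⊆q {q = q} {x = x} p⊆q∪x x∉p {y} y∈p with x∈p∪q⁻ q ⁅ x ⁆ (p⊆q∪x y∈p)
... | inj₁ y∈q = y∈q
... | inj₂ y∈⁅x⁆ = ⊥-elim (x∉p (subst (_∈ _) (x∈⁅y⁆⇒x≡y x y∈⁅x⁆) y∈p))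

x∉p⇒∣p∣<∣p∪⁅x⁆∣ : ∀ {p : Subset n} {x} → x ∉ p → ∣ p ∣ < ∣ p ∪ ⁅ x ⁆ ∣
x∉p⇒∣p∣<∣p∪⁅x⁆∣ {x = x} x∉p =
  p⊂q⇒∣p∣<∣q∣ (p⊆p∪q ⁅ x ⁆ , x , x∈p∪q⁺ (inj₂ (x∈⁅x⁆ x)) , x∉p)

∣p─r∣<∣p─q∣ : ∀ {p q r : Subset n} {x} → (∀ {y} → y ∈ p → y ∈ q → y ∈ r) →
              x ∈ p → x ∉ q → x ∈ r → ∣ p ─ r ∣ < ∣ p ─ q ∣
∣p─r∣<∣p─q∣ {p = p} {q} {r} {x} p∩q⊆r x∈p x∉q x∈r =
  p⊂q⇒∣p∣<∣q∣ (p─r⊆p─q , x , x∈p∧x∉q⇒x∈p─q x∈p x∉q , λ x∈p─r → x∈p─q⇒x∉q p r x∈p─r x∈r)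
  where
  p─r⊆p─q : p ─ r ⊆ p ─ q
  p─r⊆p─q y∈p─r = x∈p∧x∉q⇒x∈p─q y∈p λ y∈q → x∈p─q⇒x∉q p r y∈p─r (p∩q⊆r y∈p y∈q)
    where y∈p = p─q⊆p p r y∈p─r

x∈p⇒suc∣p-x∣≡∣p∣ : ∀ {p : Subset n} {x} → x ∈ p → suc ∣ p - x ∣ ≡ ∣ p ∣
x∈p⇒suc∣p-x∣≡∣p∣ {p = inside ∷ p} here = cong (suc ∘ ∣_∣) (p─⊥≡p p)
x∈p⇒suc∣p-x∣≡∣p∣ {p = inside ∷ p} (there x∈p) = cong suc (x∈p⇒suc∣p-x∣≡∣p∣ x∈p)
x∈p⇒suc∣p-x∣≡∣p∣ {p = outside ∷ p} (there x∈p) = x∈p⇒suc∣p-x∣≡∣p∣ x∈p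

injection-into-↑ʳ⇒≤ : ∀ {k m k'} (σ : Fin k → Fin (m + k')) → Injective _≡_ _≡_ σ →
                      (∀ j → ∃ λ t → m Fin.↑ʳ t ≡ σ j) → k ≤ k'
injection-into-↑ʳ⇒≤ {m = m} σ σ-injective into-↑ʳ = FinP.injective⇒≤ τ-injective
  where
  τ = λ j → proj₁ (into-↑ʳ j)
  τ-injective : Injective _≡_ _≡_ τ
  τ-injective {j} {j'} τj≡τj' = σ-injective (begin
    σ j             ≡⟨ proj₂ (into-↑ʳ j) ⟨
    m Fin.↑ʳ τ j    ≡⟨ cong (m Fin.↑ʳ_) τj≡τj' ⟩
    m Fin.↑ʳ τ j'   ≡⟨ proj₂ (into-↑ʳ j') ⟩
    σ j'            ∎)
    where open ≡-Reasoning

-- Independence defined by circuits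

module CircuitExchange {a ℓ} {n : ℕ} {V : Set a} (IsCircuit : Pred V ℓ) (support : V → Subset n) where

  Independent : Subset n → Set (a ⊔ ℓ)
  Independent J = ∀ {u} → IsCircuit u → support u ⊈ J

  IsMaximalIndependent : Subset n → Set (a ⊔ ℓ)
  IsMaximalIndependent B = Independent B × (∀ J → B ⊆ J → Independent J → J ⊆ B)

  CircuitElimination : Set (a ⊔ ℓ)
  CircuitElimination = ∀ {u s X Y} → IsCircuit u → IsCircuit s →
    X ∈ support u → X ∈ support s → Y ∈ support u → Y ∉ support s →
    ∃ λ t → IsCircuit t × X ∉ support t × support t ⊆ support u ∪ support s

  module _ (eliminate : CircuitElimination) where

    exchange : ∀ {B J X u} → Independent B → Independent J → X ∈ B →
               IsCircuit u → support u ⊆ J ∪ ⁅ X ⁆ →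
               ∃ λ Y → Y ∈ J ∪ ⁅ X ⁆ × Y ∉ B × Independent (J ∪ ⁅ X ⁆ - Y)
    exchange {B} {J} {X} {u} indB indJ X∈B u-circ u⊆J+X with nonempty? (support u ─ B)
    ... | no u⊆B = ⊥-elim (indB u-circ (Empty[p─q]⇒p⊆q u⊆B))
    ... | yes (Y , Y∈u─B) = Y , u⊆J+X Y∈u , x∈p─q⇒x∉q (support u) B Y∈u─B , independent
      where
      Y∈u = p─q⊆p (support u) B Y∈u─B

      X∈circuit : ∀ {s} → IsCircuit s → support s ⊆ J ∪ ⁅ X ⁆ → X ∈ support s
      X∈circuit {s} s-circ s⊆J+X =
        decidable-stable (X ∈? support s) (indJ s-circ ∘ p⊆q∪⁅x⁆∧x∉p⇒p⊆q s⊆J+X)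

      independent : Independent (J ∪ ⁅ X ⁆ - Y)
      independent {s} s-circ s⊆J' =
        let t , t-circ , X∉t , t⊆u∪s = eliminate u-circ s-circ (X∈circuit u-circ u⊆J+X)
                                         (X∈circuit s-circ s⊆J+X) Y∈u (x∉p-x (J ∪ ⁅ X ⁆) Y ∘ s⊆J')
        in indJ t-circ (p⊆q∪⁅x⁆∧x∉p⇒p⊆q (λ i∈t → ∪-least u⊆J+X s⊆J+X (t⊆u∪s i∈t)) X∉t)
        where
        s⊆J+X : support s ⊆ J ∪ ⁅ X ⁆
        s⊆J+X i∈s = p─q⊆p (J ∪ ⁅ X ⁆) ⁅ Y ⁆ (s⊆J' i∈s)

    ∣independent∣≤∣maximal∣ : ∀ {B J} → IsMaximalIndependent B → Independent J → ∣ J ∣ ≤ ∣ B ∣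
    ∣independent∣≤∣maximal∣ {B} (indB , maxB) = go (<-wellFounded _)
      where
      go : ∀ {J} → Acc _<_ ∣ B ─ J ∣ → Independent J → ∣ J ∣ ≤ ∣ B ∣
      go {J} (acc rec) indJ with nonempty? (B ─ J)
      ... | no B⊆J = p⊆q⇒∣p∣≤∣q∣ (maxB J (Empty[p─q]⇒p⊆q B⊆J) indJ)
      ... | yes (X , X∈B─J) =
        decidable-stable (∣ J ∣ ℕ.≤? ∣ B ∣) λ J≰B → J≰B (grow λ u-circ u⊆ → J≰B (swap u-circ u⊆))
        where
        X∈B = p─q⊆p B J X∈B─J
        X∉J = x∈p─q⇒x∉q B J X∈B─J
        X∈J+X = x∈p∪q⁺ (inj₂ (x∈⁅x⁆ X))
        ∣J∣<∣J+X∣ = x∉p⇒∣p∣<∣p∪⁅x⁆∣ X∉J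
        grow : Independent (J ∪ ⁅ X ⁆) → ∣ J ∣ ≤ ∣ B ∣
        grow indJ+X = ℕP.<⇒≤ (ℕP.<-≤-trans ∣J∣<∣J+X∣
          (go (rec (∣p─r∣<∣p─q∣ (λ _ → p⊆p∪q ⁅ X ⁆) X∈B X∉J X∈J+X)) indJ+X))
        swap : ∀ {u} → IsCircuit u → support u ⊆ J ∪ ⁅ X ⁆ → ∣ J ∣ ≤ ∣ B ∣
        swap u-circ u⊆J+X with exchange indB indJ X∈B u-circ u⊆J+X
        ... | Y , Y∈J+X , Y∉B , indJ' = ℕP.≤-trans ∣J∣≤∣J'∣ (go (rec B─J'<B─J) indJ')
          where
          ≢Y : ∀ {i} → i ∈ B → i ≢ Y
          ≢Y i∈B refl = Y∉B i∈B
          ∣J∣≤∣J'∣ : ∣ J ∣ ≤ ∣ J ∪ ⁅ X ⁆ - Y ∣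
          ∣J∣≤∣J'∣ = ℕP.≤-pred (subst (suc ∣ J ∣ ≤_) (sym (x∈p⇒suc∣p-x∣≡∣p∣ Y∈J+X)) ∣J∣<∣J+X∣)
          B─J'<B─J : ∣ B ─ (J ∪ ⁅ X ⁆ - Y) ∣ < ∣ B ─ J ∣
          B─J'<B─J = ∣p─r∣<∣p─q∣ (λ i∈B i∈J → x∈p∧x≢y⇒x∈p-y (p⊆p∪q ⁅ X ⁆ i∈J) (≢Y i∈B))
                       X∈B X∉J (x∈p∧x≢y⇒x∈p-y X∈J+X (≢Y X∈B))

    maximal-independent-sets-equicardinal : ∀ {B B'} → IsMaximalIndependent B → IsMaximalIndependent B' →
                                            ∣ B ∣ ≡ ∣ B' ∣
    maximal-independent-sets-equicardinal maxB maxB' =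
      ℕP.≤-antisym (∣independent∣≤∣maximal∣ maxB' (proj₁ maxB)) (∣independent∣≤∣maximal∣ maxB (proj₁ maxB'))

sum-mono-≤ : ∀ {f g : Fin n → ℕ} → (∀ i → f i ≤ g i) → sum f ≤ sum g
sum-mono-≤ {zero} f≤g = z≤n
sum-mono-≤ {suc n} f≤g = ℕP.+-mono-≤ (f≤g zero) (sum-mono-≤ (f≤g ∘ suc))

sum-mono-< : ∀ {f g : Fin n → ℕ} {k} → (∀ i → f i ≤ g i) → f k < g k → sum f < sum g
sum-mono-< {suc n} {f} {g} {k} f≤g fk<gk = begin-strict
  sum f                           ≡⟨ sum-remove {i = k} f ⟩
  f k + sum (f ∘ Fin.punchIn k)   <⟨ ℕP.+-mono-<-≤ fk<gk (sum-mono-≤ (f≤g ∘ Fin.punchIn k)) ⟩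
  g k + sum (g ∘ Fin.punchIn k)   ≡⟨ sum-remove {i = k} g ⟨
  sum g                           ∎
  where open ℕP.≤-Reasoning

f≤sum[f] : ∀ (f : Fin n → ℕ) k → f k ≤ sum f
f≤sum[f] {suc n} f k = subst (f k ≤_) (sym (sum-remove {i = k} f)) (ℕP.m≤m+n (f k) _)

0<sum⇒∃0< : ∀ (f : Fin n → ℕ) → 0 < sum f → ∃ λ i → 0 < f i
0<sum⇒∃0< {suc n} f 0<sum with f zero in eq
... | suc _ = zero , subst (0 <_) (sym eq) (s≤s z≤n)
... | zero with 0<sum⇒∃0< (f ∘ suc) 0<sum
...   | i , 0<fi = suc i , 0<fi

sum-cancel : ∀ {a b f g : Fin n → ℕ} → (∀ i → f i + b i ≡ g i + a i) → sum a ≡ sum b → sum f ≡ sum g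
sum-cancel {a = a} {b} {f} {g} f+b≡g+a Σa≡Σb = ℕP.+-cancelʳ-≡ (sum b) (sum f) (sum g) (begin
  sum f + sum b                ≡⟨ ∑-distrib-+ f b ⟨
  sum (λ i → f i + b i)        ≡⟨ sum-cong-≗ f+b≡g+a ⟩
  sum (λ i → g i + a i)        ≡⟨ ∑-distrib-+ g a ⟩
  sum g + sum a                ≡⟨ cong (_+_ (sum g)) Σa≡Σb ⟩
  sum g + sum b                ∎)
  where open ≡-Reasoning

m∸n+n≡n∸m+m : ∀ m n → m ∸ n + n ≡ n ∸ m + m
m∸n+n≡n∸m+m m n with ℕP.≤-total n m
... | inj₁ n≤m rewrite ℕP.m∸n+n≡m n≤m | ℕP.m≤n⇒m∸n≡0 n≤m = refl
... | inj₂ m≤n rewrite ℕP.m∸n+n≡m m≤n | ℕP.m≤n⇒m∸n≡0 m≤n = refl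

m∸n<m : ∀ {m n} → 0 < m → 0 < n → m ∸ n < m
m∸n<m {suc m} {suc n} _ _ = s≤s (ℕP.m∸n≤m m n)

δ : Fin n → Fin n → ℕ
δ zero    zero    = 1
δ zero    (suc _) = 0
δ (suc _) zero    = 0
δ (suc i) (suc j) = δ i j

δ-refl : ∀ (i : Fin n) → δ i i ≡ 1
δ-refl zero    = refl
δ-refl (suc i) = δ-refl i

0<δ⇒≡ : ∀ (i j : Fin n) → 0 < δ i j → i ≡ j
0<δ⇒≡ zero    zero    _    = refl
0<δ⇒≡ (suc i) (suc j) 0<δ = cong suc (0<δ⇒≡ i j 0<δ)

sum-δ : ∀ (i : Fin n) → sum (δ i) ≡ 1
sum-δ {suc n} zero    = cong suc (sum-replicate-zero n)
sum-δ {suc n} (suc i) = sum-δ i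

multiplicity : ∀ {m} → (Fin m → Fin n) → Fin n → ℕ
multiplicity p i = sum (λ j → δ (p j) i)

sum-multiplicity : ∀ {m} (p : Fin m → Fin n) → sum (multiplicity p) ≡ m
sum-multiplicity {n} {zero}  p = sum-replicate-zero n
sum-multiplicity {n} {suc m} p = begin
  sum (multiplicity p)                             ≡⟨ ∑-distrib-+ (δ (p zero)) (multiplicity (p ∘ suc)) ⟩
  sum (δ (p zero)) + sum (multiplicity (p ∘ suc))  ≡⟨ cong₂ _+_ (sum-δ (p zero)) (sum-multiplicity (p ∘ suc)) ⟩
  suc m                                            ∎
  where open ≡-Reasoning

0<multiplicity⇒∈image : ∀ {m} (p : Fin m → Fin n) i → 0 < multiplicity p i → ∃ λ j → p j ≡ i
0<multiplicity⇒∈image p i 0<mult with 0<sum⇒∃0< (λ j → δ (p j) i) 0<mult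
... | j , 0<δ = j , 0<δ⇒≡ (p j) i 0<δ

0<multiplicity[p[j]] : ∀ {m} (p : Fin m → Fin n) j → 0 < multiplicity p (p j)
0<multiplicity[p[j]] p j =
  subst (_≤ multiplicity p (p j)) (δ-refl (p j)) (f≤sum[f] (λ j' → δ (p j') (p j)) j)

multiplicity-punchIn : ∀ {m} (p : Fin (suc m) → Fin n) k i →
                       multiplicity p i ≡ δ (p k) i + multiplicity (p ∘ Fin.punchIn k) i
multiplicity-punchIn p k i = sum-remove {i = k} (λ j → δ (p j) i)

rearrangement : ∀ {m} (p p' : Fin m → Fin n) → (∀ i → multiplicity p i ≡ multiplicity p' i) →
                Σ (Fin m → Fin m) λ σ → Injective _≡_ _≡_ σ × (∀ j → p' (σ j) ≡ p j)
rearrangement {m = zero}  p p' same = (λ ()) , (λ {}) , (λ ())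
rearrangement {m = suc m} p p' same = σ , σ-injective , p'∘σ≗p
  where
  k,p'k≡p0 = 0<multiplicity⇒∈image p' (p zero) (subst (0 <_) (same (p zero)) (0<multiplicity[p[j]] p zero))
  k = proj₁ k,p'k≡p0
  p'k≡p0 = proj₂ k,p'k≡p0

  same-rest : ∀ i → multiplicity (p ∘ suc) i ≡ multiplicity (p' ∘ Fin.punchIn k) i
  same-rest i = ℕP.+-cancelˡ-≡ (δ (p zero) i) _ _ (begin
    δ (p zero) i + multiplicity (p ∘ suc) i             ≡⟨ same i ⟩
    multiplicity p' i                                   ≡⟨ multiplicity-punchIn p' k i ⟩
    δ (p' k) i + multiplicity (p' ∘ Fin.punchIn k) i    ≡⟨ cong (λ l → δ l i + μ'₀ i) p'k≡p0 ⟩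
    δ (p zero) i + multiplicity (p' ∘ Fin.punchIn k) i  ∎)
    where
    open ≡-Reasoning
    μ'₀ = multiplicity (p' ∘ Fin.punchIn k)

  rest = rearrangement (p ∘ suc) (p' ∘ Fin.punchIn k) same-rest
  σ₀ = proj₁ rest

  σ : Fin (suc m) → Fin (suc m)
  σ zero    = k
  σ (suc j) = Fin.punchIn k (σ₀ j)

  σ-injective : Injective _≡_ _≡_ σ
  σ-injective {zero}  {zero}   _   = refl
  σ-injective {zero}  {suc j}  eq  = ⊥-elim (FinP.punchInᵢ≢i k (σ₀ j) (sym eq))
  σ-injective {suc j} {zero}   eq  = ⊥-elim (FinP.punchInᵢ≢i k (σ₀ j) eq)
  σ-injective {suc j} {suc j'} eq  = cong suc (proj₁ (proj₂ rest) (FinP.punchIn-injective k _ _ eq))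

  p'∘σ≗p : ∀ j → p' (σ j) ≡ p j
  p'∘σ≗p zero    = p'k≡p0
  p'∘σ≗p (suc j) = proj₂ (proj₂ rest) j

enumerate : (c : Fin n → ℕ) → Fin (sum c) → Fin n
enumerate {zero}  c ()
enumerate {suc n} c = replicate (c zero) zero ++ (suc ∘ enumerate (c ∘ suc))

0<c[enumerate] : ∀ (c : Fin n → ℕ) j → 0 < c (enumerate c j)
0<c[enumerate] {suc n} c j with splitAt (c zero) j
... | inj₂ j' = 0<c[enumerate] (c ∘ suc) j'
... | inj₁ _ with c zero
...   | suc _ = s≤s z≤n

module _ {c ℓ : Level} (Γ : AbelianGroup c ℓ) where
  open AbelianGroup Γ renaming (refl to ≈-refl; sym to ≈-sym; trans to ≈-trans)
  open RawMonoidDefinitions rawMonoid using () renaming (_×_ to _·_)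
  open MonoidMult monoid using (×-congˡ; ×-homo-+; ×-homo-1)
  open GroupProperties group using (∙-cancelʳ)
  open CommutativeMonoidSum commutativeMonoid using ()
    renaming (∑-distrib-+ to ΣΓ-distrib-∙; sum-replicate to ΣΓ-replicate; sum-replicate-zero to ΣΓ-ε)
  open import Relation.Binary.Reasoning.Setoid setoid

  ΣΓ-cong : ∀ {m} {f g : Fin m → Carrier} → (∀ i → f i ≈ g i) → ΣΓ Γ f ≈ ΣΓ Γ g
  ΣΓ-cong = CommutativeMonoidSum.sum-cong-≋ commutativeMonoid

  ΣΓ-++ : ∀ {m k} (f : Fin m → Carrier) (g : Fin k → Carrier) → ΣΓ Γ (f ++ g) ≈ ΣΓ Γ f ∙ ΣΓ Γ g
  ΣΓ-++ {zero}  f g = ≈-sym (identityˡ _)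
  ΣΓ-++ {suc m} f g = begin
    f zero ∙ ΣΓ Γ ((f ++ g) ∘ suc)      ≈⟨ ∙-congˡ (ΣΓ-cong (λ i → reflexive ([,]-map (splitAt m i)))) ⟩
    f zero ∙ ΣΓ Γ ((f ∘ suc) ++ g)      ≈⟨ ∙-congˡ (ΣΓ-++ (f ∘ suc) g) ⟩
    f zero ∙ (ΣΓ Γ (f ∘ suc) ∙ ΣΓ Γ g)  ≈⟨ assoc _ _ _ ⟨
    ΣΓ Γ f ∙ ΣΓ Γ g                     ∎

  ΣΓ-cast : ∀ {m m'} (eq : m ≡ m') (f : Fin m' → Carrier) → ΣΓ Γ (f ∘ Fin.cast eq) ≈ ΣΓ Γ f
  ΣΓ-cast refl f = ΣΓ-cong (λ j → reflexive (cong f (FinP.cast-is-id refl j)))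

  combination : (Fin n → Carrier) → (Fin n → ℕ) → Carrier
  combination x c = ΣΓ Γ (λ i → c i · x i)

  module _ (x : Fin n → Carrier) where

    combination-cong : ∀ {c d} → (∀ i → c i ≡ d i) → combination x c ≈ combination x d
    combination-cong c≗d = ΣΓ-cong (λ i → ×-congˡ (c≗d i))

    combination-+ : ∀ c d → combination x (λ i → c i + d i) ≈ combination x c ∙ combination x d
    combination-+ c d =
      ≈-trans (ΣΓ-cong (λ i → ×-homo-+ (x i) (c i) (d i))) (ΣΓ-distrib-∙ (λ i → c i · x i) (λ i → d i · x i))

    combination-cancel : ∀ {a b f g} → (∀ i → f i + b i ≡ g i + a i) →
                         combination x a ≈ combination x b → combination x f ≈ combination x g
    combination-cancel {a} {b} {f} {g} f+b≡g+a a≈b = ∙-cancelʳ (combination x b) _ _ (begin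
      combination x f ∙ combination x b    ≈⟨ combination-+ f b ⟨
      combination x (λ i → f i + b i)      ≈⟨ combination-cong f+b≡g+a ⟩
      combination x (λ i → g i + a i)      ≈⟨ combination-+ g a ⟩
      combination x g ∙ combination x a    ≈⟨ ∙-congˡ a≈b ⟩
      combination x g ∙ combination x b    ∎)

  combination-δ : ∀ (x : Fin n → Carrier) k → combination x (δ k) ≈ x k
  combination-δ {suc n} x zero    = ≈-trans (∙-cong (×-homo-1 (x zero)) (ΣΓ-ε n)) (identityʳ _)
  combination-δ {suc n} x (suc k) = ≈-trans (identityˡ _) (combination-δ (x ∘ suc) k)

  combination-multiplicity : ∀ (x : Fin n → Carrier) {m} (p : Fin m → Fin n) →
                             ΣΓ Γ (x ∘ p) ≈ combination x (multiplicity p)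
  combination-multiplicity {n} x {zero}  p = ≈-sym (ΣΓ-ε n)
  combination-multiplicity     x {suc m} p = begin
    x (p zero) ∙ ΣΓ Γ (x ∘ p ∘ suc)
      ≈⟨ ∙-cong (≈-sym (combination-δ x (p zero))) (combination-multiplicity x (p ∘ suc)) ⟩
    combination x (δ (p zero)) ∙ combination x (multiplicity (p ∘ suc))
      ≈⟨ combination-+ x (δ (p zero)) (multiplicity (p ∘ suc)) ⟨
    combination x (multiplicity p)
      ∎

  combination-enumerate : ∀ (x : Fin n → Carrier) c → ΣΓ Γ (x ∘ enumerate c) ≈ combination x c
  combination-enumerate {zero}  x c = ≈-refl
  combination-enumerate {suc n} x c = begin
    ΣΓ Γ (x ∘ enumerate c)
      ≈⟨ ΣΓ-cong (λ j → reflexive ([,]-∘ x (splitAt (c zero) j))) ⟩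
    ΣΓ Γ (replicate (c zero) (x zero) ++ (x ∘ suc ∘ enumerate (c ∘ suc)))
      ≈⟨ ΣΓ-++ (replicate (c zero) (x zero)) (x ∘ suc ∘ enumerate (c ∘ suc)) ⟩
    ΣΓ Γ (replicate (c zero) (x zero)) ∙ ΣΓ Γ (x ∘ suc ∘ enumerate (c ∘ suc))
      ≈⟨ ∙-cong (ΣΓ-replicate (c zero)) (combination-enumerate (x ∘ suc) (c ∘ suc)) ⟩
    combination x c
      ∎

-- Integer vectors and Euclidean elimination

_⁺ : ℤ → ℕ
(+ n)    ⁺ = n
-[1+ n ] ⁺ = 0

_⁻ : ℤ → ℕ
(+ n)    ⁻ = 0
-[1+ n ] ⁻ = suc n

⁺⊖⁻ : ∀ z → z ⁺ ⊖ z ⁻ ≡ z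
⁺⊖⁻ (+ n)    = ℤP.⊖-≥ z≤n
⁺⊖⁻ -[1+ n ] = refl

⁺-⊖ : ∀ m n → (m ⊖ n) ⁺ ≡ m ∸ n
⁺-⊖ zero    zero    = refl
⁺-⊖ zero    (suc n) = refl
⁺-⊖ (suc m) zero    = refl
⁺-⊖ (suc m) (suc n) = trans (cong _⁺ (ℤP.[1+m]⊖[1+n]≡m⊖n m n)) (⁺-⊖ m n)

⁻-⊖ : ∀ m n → (m ⊖ n) ⁻ ≡ n ∸ m
⁻-⊖ zero    zero    = refl
⁻-⊖ zero    (suc n) = refl
⁻-⊖ (suc m) zero    = refl
⁻-⊖ (suc m) (suc n) = trans (cong _⁻ (ℤP.[1+m]⊖[1+n]≡m⊖n m n)) (⁻-⊖ m n)

⁺-neg : ∀ z → (ℤ.- z) ⁺ ≡ z ⁻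
⁺-neg (+ zero)  = refl
⁺-neg (+ suc n) = refl
⁺-neg -[1+ n ]  = refl

neg≡⁻⊖⁺ : ∀ z → ℤ.- z ≡ z ⁻ ⊖ z ⁺
neg≡⁻⊖⁺ z = trans (cong ℤ.-_ (sym (⁺⊖⁻ z))) (sym (ℤP.⊖-swap (z ⁻) (z ⁺)))

sub≡⊖ : ∀ a b → a ℤ.- b ≡ (a ⁺ + b ⁻) ⊖ (a ⁻ + b ⁺)
sub≡⊖ a b = begin
  a ℤ.- b                                         ≡⟨ cong₂ ℤ._-_ (split a) (split b) ⟨
  (+ a ⁺ ℤ.- + a ⁻) ℤ.- (+ b ⁺ ℤ.- + b ⁻)         ≡⟨ regroup (+ a ⁺) (+ a ⁻) (+ b ⁺) (+ b ⁻) ⟩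
  (+ a ⁺ ℤ.+ + b ⁻) ℤ.- (+ a ⁻ ℤ.+ + b ⁺)         ≡⟨ cong₂ ℤ._-_ (ℤP.pos-+ (a ⁺) (b ⁻)) (ℤP.pos-+ (a ⁻) (b ⁺)) ⟨
  + (a ⁺ + b ⁻) ℤ.- + (a ⁻ + b ⁺)                 ≡⟨ ℤP.[+m]-[+n]≡m⊖n (a ⁺ + b ⁻) (a ⁻ + b ⁺) ⟩
  (a ⁺ + b ⁻) ⊖ (a ⁻ + b ⁺)                       ∎
  where
  open ≡-Reasoning
  split : ∀ z → + z ⁺ ℤ.- + z ⁻ ≡ z
  split z = trans (ℤP.[+m]-[+n]≡m⊖n (z ⁺) (z ⁻)) (⁺⊖⁻ z)
  regroup : ∀ p q r s → (p ℤ.- q) ℤ.- (r ℤ.- s) ≡ (p ℤ.+ s) ℤ.- (q ℤ.+ r)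
  regroup = solve-∀

m⊖n≡0⇒m≡n : ∀ {m n} → m ⊖ n ≡ 0ℤ → m ≡ n
m⊖n≡0⇒m≡n {m} {n} m⊖n≡0 = ℤP.+-injective (ℤP.i-j≡0⇒i≡j (+ m) (+ n) (trans (ℤP.[+m]-[+n]≡m⊖n m n) m⊖n≡0))

0<[m⊖n]⁺⇒0<m : ∀ m n → 0 < (m ⊖ n) ⁺ → 0 < m
0<[m⊖n]⁺⇒0<m m n 0<⁺ = ℕP.<-≤-trans (subst (0 <_) (⁺-⊖ m n) 0<⁺) (ℕP.m∸n≤m m n)

0<[m⊖n]⁻⇒0<n : ∀ m n → 0 < (m ⊖ n) ⁻ → 0 < n
0<[m⊖n]⁻⇒0<n m n 0<⁻ = ℕP.<-≤-trans (subst (0 <_) (⁻-⊖ m n) 0<⁻) (ℕP.m∸n≤m n m)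

≢0⇒0<⁺⊎0<⁻ : ∀ {z} → z ≢ 0ℤ → 0 < z ⁺ ⊎ 0 < z ⁻
≢0⇒0<⁺⊎0<⁻ {+ zero}  z≢0 = ⊥-elim (z≢0 refl)
≢0⇒0<⁺⊎0<⁻ {+ suc n} _   = inj₁ (s≤s z≤n)
≢0⇒0<⁺⊎0<⁻ { -[1+ n ]} _ = inj₂ (s≤s z≤n)

0<⁺⇒≢0 : ∀ {z} → 0 < z ⁺ → z ≢ 0ℤ
0<⁺⇒≢0 {+ suc n} _ ()

0<⁻⇒≢0 : ∀ {z} → 0 < z ⁻ → z ≢ 0ℤ
0<⁻⇒≢0 { -[1+ n ]} _ ()

0<⁺⇒¬0<⁻ : ∀ {z} → 0 < z ⁺ → ¬ (0 < z ⁻)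
0<⁺⇒¬0<⁻ {+ n} _ ()

0<⇒0<⁺ : ∀ {z} → 0ℤ ℤ.< z → 0 < z ⁺
0<⇒0<⁺ (ℤ.+<+ 0<n) = 0<n

Nontrivial : ∀ {a} {I : Set a} → (I → ℤ) → Set a
Nontrivial r = ∃ λ i → r i ≢ 0ℤ

+[1+q]-+[1+p]≡+[1+o] : ∀ {p q} → p < q → ∃ λ o → + suc q ℤ.- + suc p ≡ + suc o × o < q
+[1+q]-+[1+p]≡+[1+o] {p} {q} p<q = q ∸ suc p , difference , ℕP.∸-monoʳ-< {q} (s≤s z≤n) p<q
  where
  difference : + suc q ℤ.- + suc p ≡ + suc (q ∸ suc p)
  difference = begin
    + suc q ℤ.- + suc p    ≡⟨ ℤP.[+m]-[+n]≡m⊖n (suc q) (suc p) ⟩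
    suc q ⊖ suc p          ≡⟨ ℤP.⊖-≥ (s≤s (ℕP.<⇒≤ p<q)) ⟩
    + (q ∸ p)              ≡⟨ cong +_ (ℕP.+-∸-assoc 1 p<q) ⟩
    + suc (q ∸ suc p)      ∎
    where open ≡-Reasoning

neg-≢0 : ∀ {z} → z ≢ 0ℤ → ℤ.- z ≢ 0ℤ
neg-≢0 {z} z≢0 -z≡0 = z≢0 (ℤP.neg-injective -z≡0)

module Elimination {a p} {I : Set a} (P : Pred (I → ℤ) p)
  (P-neg : ∀ {r} → P r → P (ℤ.-_ ∘ r))
  (P-sub : ∀ {r s X} → P r → P s → 0ℤ ℤ.< r X → 0ℤ ℤ.< s X →
           Nontrivial (λ i → r i ℤ.- s i) → P (λ i → r i ℤ.- s i))
  where

  det : I → I → (I → ℤ) → (I → ℤ) → ℤ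
  det X Y r s = r X ℤ.* s Y ℤ.- r Y ℤ.* s X

  private
    det-subˡ : ∀ a b c d → (a ℤ.- c) ℤ.* d ℤ.- (b ℤ.- d) ℤ.* c ≡ a ℤ.* d ℤ.- b ℤ.* c
    det-subˡ = solve-∀
    det-subʳ : ∀ a b c d → a ℤ.* (d ℤ.- b) ℤ.- b ℤ.* (c ℤ.- a) ≡ a ℤ.* d ℤ.- b ℤ.* c
    det-subʳ = solve-∀
    det-negˡ : ∀ a b c d → (ℤ.- a) ℤ.* d ℤ.- (ℤ.- b) ℤ.* c ≡ ℤ.- (a ℤ.* d ℤ.- b ℤ.* c)
    det-negˡ = solve-∀
    det-negʳ : ∀ a b c d → a ℤ.* (ℤ.- d) ℤ.- b ℤ.* (ℤ.- c) ≡ ℤ.- (a ℤ.* d ℤ.- b ℤ.* c)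
    det-negʳ = solve-∀
    det-neg : ∀ a b c d → (ℤ.- a) ℤ.* (ℤ.- d) ℤ.- (ℤ.- b) ℤ.* (ℤ.- c) ≡ a ℤ.* d ℤ.- b ℤ.* c
    det-neg = solve-∀
    det-diagonal : ∀ c d → c ℤ.* d ℤ.- d ℤ.* c ≡ 0ℤ
    det-diagonal = solve-∀
    det-zero : ∀ a b c → a ℤ.* 0ℤ ℤ.- b ℤ.* c ≡ ℤ.- (b ℤ.* c)
    det-zero = solve-∀

  0<+[1+n] : ∀ {z n} → z ≡ + suc n → 0ℤ ℤ.< z
  0<+[1+n] refl = ℤ.+<+ (s≤s z≤n)

  +[1+n]≢0 : ∀ {z n} → z ≡ + suc n → z ≢ 0ℤ
  +[1+n]≢0 refl ()

  -- Subtracting one vector from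
  -- the other leaves det X Y unchanged, so when the coefficients at X finally agree, the
  -- difference is nonzero at Y.
  euclid : ∀ {X Y r s p q} → Acc _<_ (p + q) → r X ≡ + suc p → s X ≡ + suc q →
           P r → P s → det X Y r s ≢ 0ℤ → ∃ λ t → P t × t X ≡ 0ℤ × t Y ≢ 0ℤ
  euclid {X} {Y} {r} {s} {p} {q} (acc rec) rX sX Pr Ps det≢0 with ℕP.<-cmp p q
  ... | tri≈ _ refl _ = (λ i → r i ℤ.- s i) , P-sub Pr Ps (0<+[1+n] rX) (0<+[1+n] sX) (Y , tY≢0) , tX≡0 , tY≢0
    where
    tX≡0 : r X ℤ.- s X ≡ 0ℤ
    tX≡0 = trans (cong₂ ℤ._-_ rX sX) (ℤP.+-inverseʳ (+ suc p))
    tY≢0 : r Y ℤ.- s Y ≢ 0ℤ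
    tY≢0 tY≡0 = det≢0 (begin
      r X ℤ.* s Y ℤ.- r Y ℤ.* s X   ≡⟨ cong₂ (λ a b → a ℤ.* s Y ℤ.- b ℤ.* s X) rX≡sX rY≡sY ⟩
      s X ℤ.* s Y ℤ.- s Y ℤ.* s X   ≡⟨ det-diagonal (s X) (s Y) ⟩
      0ℤ                            ∎)
      where
      open ≡-Reasoning
      rX≡sX = trans rX (sym sX)
      rY≡sY = ℤP.i-j≡0⇒i≡j (r Y) (s Y) tY≡0
  ... | tri< p<q _ _ =
    let o , sX-rX , o<q = +[1+q]-+[1+p]≡+[1+o] p<q
        s'X = trans (cong₂ ℤ._-_ sX rX) sX-rX
    in euclid (rec (ℕP.+-monoʳ-< p o<q)) rX s'X Pr
         (P-sub Ps Pr (0<+[1+n] sX) (0<+[1+n] rX) (X , +[1+n]≢0 s'X))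
         (det≢0 ∘ trans (sym (det-subʳ (r X) (r Y) (s X) (s Y))))
  ... | tri> _ _ q<p =
    let o , rX-sX , o<p = +[1+q]-+[1+p]≡+[1+o] q<p
        r'X = trans (cong₂ ℤ._-_ rX sX) rX-sX
    in euclid (rec (ℕP.+-monoˡ-< q o<p)) r'X sX
         (P-sub Pr Ps (0<+[1+n] rX) (0<+[1+n] sX) (X , +[1+n]≢0 r'X)) Ps
         (det≢0 ∘ trans (sym (det-subˡ (r X) (r Y) (s X) (s Y))))

  positive-or-negated : ∀ {z} → z ≢ 0ℤ → (∃ λ n → z ≡ + suc n) ⊎ (∃ λ n → ℤ.- z ≡ + suc n)
  positive-or-negated {+ zero}   z≢0 = ⊥-elim (z≢0 refl)
  positive-or-negated {+ suc n}  _   = inj₁ (n , refl)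
  positive-or-negated { -[1+ n ]} _  = inj₂ (n , refl)

  eliminate-by-det : ∀ {X Y r s} → P r → P s → r X ≢ 0ℤ → s X ≢ 0ℤ → det X Y r s ≢ 0ℤ →
                     ∃ λ t → P t × t X ≡ 0ℤ × t Y ≢ 0ℤ
  eliminate-by-det {X} {Y} {r} {s} Pr Ps rX≢0 sX≢0 det≢0
    with positive-or-negated rX≢0 | positive-or-negated sX≢0
  ... | inj₁ (_ , rX) | inj₁ (_ , sX) = euclid (<-wellFounded _) rX sX Pr Ps det≢0
  ... | inj₁ (_ , rX) | inj₂ (_ , sX) = euclid (<-wellFounded _) rX sX Pr (P-neg Ps)
    (neg-≢0 det≢0 ∘ trans (sym (det-negʳ (r X) (r Y) (s X) (s Y))))
  ... | inj₂ (_ , rX) | inj₁ (_ , sX) = euclid (<-wellFounded _) rX sX (P-neg Pr) Ps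
    (neg-≢0 det≢0 ∘ trans (sym (det-negˡ (r X) (r Y) (s X) (s Y))))
  ... | inj₂ (_ , rX) | inj₂ (_ , sX) = euclid (<-wellFounded _) rX sX (P-neg Pr) (P-neg Ps)
    (det≢0 ∘ trans (sym (det-neg (r X) (r Y) (s X) (s Y))))

  sY≡0⇒det≢0 : ∀ {X Y r s} → r Y ≢ 0ℤ → s X ≢ 0ℤ → s Y ≡ 0ℤ → det X Y r s ≢ 0ℤ
  sY≡0⇒det≢0 {X} {Y} {r} {s} rY≢0 sX≢0 sY≡0 det≡0 = neg-≢0 rY*sX≢0 (begin
    ℤ.- (r Y ℤ.* s X)              ≡⟨ det-zero (r X) (r Y) (s X) ⟨
    r X ℤ.* 0ℤ ℤ.- r Y ℤ.* s X     ≡⟨ cong (λ d → r X ℤ.* d ℤ.- r Y ℤ.* s X) sY≡0 ⟨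
    det X Y r s                    ≡⟨ det≡0 ⟩
    0ℤ                             ∎)
    where
    open ≡-Reasoning
    rY*sX≢0 : r Y ℤ.* s X ≢ 0ℤ
    rY*sX≢0 rY*sX≡0 = [ rY≢0 , sX≢0 ]′ (ℤP.i*j≡0⇒i≡0∨j≡0 (r Y) rY*sX≡0)

  eliminate : ∀ {X Y r s} → P r → P s → r X ≢ 0ℤ → s X ≢ 0ℤ → r Y ≢ 0ℤ → s Y ≡ 0ℤ →
              ∃ λ t → P t × t X ≡ 0ℤ × t Y ≢ 0ℤ
  eliminate {X} {Y} {r} {s} Pr Ps rX≢0 sX≢0 rY≢0 sY≡0 =
    eliminate-by-det Pr Ps rX≢0 sX≢0 (sY≡0⇒det≢0 {X} {Y} {r} {s} rY≢0 sX≢0 sY≡0)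

-- Relations and B_h-sets

weight : (Fin n → ℤ) → ℕ
weight r = sum (_⁺ ∘ r)

support : (Fin n → ℤ) → Subset n
support r = Vec.tabulate (λ i → isNo (r i ℤ.≟ 0ℤ))

∈-support⇒≢0 : ∀ {r : Fin n → ℤ} {i} → i ∈ support r → r i ≢ 0ℤ
∈-support⇒≢0 {r = r} {i} i∈r
  with r i ℤ.≟ 0ℤ | trans (sym (VecP.lookup∘tabulate _ i)) (VecP.[]=⇒lookup i∈r)
... | yes _   | ()
... | no r≢0  | _ = r≢0

≢0⇒∈-support : ∀ {r : Fin n → ℤ} {i} → r i ≢ 0ℤ → i ∈ support r
≢0⇒∈-support {r = r} {i} r≢0 = VecP.lookup⇒[]= i _ (trans (VecP.lookup∘tabulate _ i) isNo≡true)
  where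
  isNo≡true : isNo (r i ℤ.≟ 0ℤ) ≡ true
  isNo≡true with r i ℤ.≟ 0ℤ
  ... | yes r≡0 = ⊥-elim (r≢0 r≡0)
  ... | no _    = refl

weight-⊖ : ∀ (a b : Fin n → ℕ) → weight (λ i → a i ⊖ b i) ≤ sum a
weight-⊖ a b = sum-mono-≤ λ i → ℕP.≤-trans (ℕP.≤-reflexive (⁺-⊖ (a i) (b i))) (ℕP.m∸n≤m (a i) (b i))

support-neg : ∀ (r : Fin n → ℤ) → support (ℤ.-_ ∘ r) ⊆ support r
support-neg r i∈-r = ≢0⇒∈-support λ r≡0 → ∈-support⇒≢0 i∈-r (cong ℤ.-_ r≡0)

support-sub : ∀ (r s : Fin n → ℤ) → support (λ i → r i ℤ.- s i) ⊆ support r ∪ support s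
support-sub r s {i} i∈r-s with r i ℤ.≟ 0ℤ | s i ℤ.≟ 0ℤ
... | no r≢0  | _        = x∈p∪q⁺ (inj₁ (≢0⇒∈-support r≢0))
... | yes _   | no s≢0   = x∈p∪q⁺ (inj₂ (≢0⇒∈-support s≢0))
... | yes r≡0 | yes s≡0  = ⊥-elim (∈-support⇒≢0 i∈r-s (cong₂ ℤ._-_ r≡0 s≡0))

module Relations {c ℓ : Level} (Γ : AbelianGroup c ℓ) {n : ℕ} (x : Fin n → AbelianGroup.Carrier Γ) where
  open AbelianGroup Γ using (_≈_; ∙-cong) renaming (refl to ≈-refl; sym to ≈-sym; trans to ≈-trans)

  IsRelation : (Fin n → ℤ) → Set ℓ
  IsRelation r = sum (_⁺ ∘ r) ≡ sum (_⁻ ∘ r) × combination Γ x (_⁺ ∘ r) ≈ combination Γ x (_⁻ ∘ r)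

  isRelation-≗ : ∀ {r s} → (∀ i → r i ≡ s i) → IsRelation r → IsRelation s
  isRelation-≗ r≗s (Σr⁺≡Σr⁻ , r⁺≈r⁻) =
    trans (sum-cong-≗ (sym ∘ cong _⁺ ∘ r≗s)) (trans Σr⁺≡Σr⁻ (sum-cong-≗ (cong _⁻ ∘ r≗s))) ,
    ≈-trans (combination-cong Γ x (sym ∘ cong _⁺ ∘ r≗s)) (≈-trans r⁺≈r⁻ (combination-cong Γ x (cong _⁻ ∘ r≗s)))

  isRelation-⊖ : ∀ a b → sum a ≡ sum b → combination Γ x a ≈ combination Γ x b → IsRelation (λ i → a i ⊖ b i)
  isRelation-⊖ a b Σa≡Σb a≈b =
    trans (sum-cong-≗ ⁺≗) (trans (sum-cancel a∸b+b≡b∸a+a Σa≡Σb) (sym (sum-cong-≗ ⁻≗))) ,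
    ≈-trans (combination-cong Γ x ⁺≗)
      (≈-trans (combination-cancel Γ x {a} {b} a∸b+b≡b∸a+a a≈b) (≈-sym (combination-cong Γ x ⁻≗)))
    where
    ⁺≗ = λ i → ⁺-⊖ (a i) (b i)
    ⁻≗ = λ i → ⁻-⊖ (a i) (b i)
    a∸b+b≡b∸a+a : ∀ i → (a i ∸ b i) + b i ≡ (b i ∸ a i) + a i
    a∸b+b≡b∸a+a i = m∸n+n≡n∸m+m (a i) (b i)

  isRelation-neg : ∀ {r} → IsRelation r → IsRelation (ℤ.-_ ∘ r)
  isRelation-neg {r} (Σr⁺≡Σr⁻ , r⁺≈r⁻) =
    isRelation-≗ (sym ∘ neg≡⁻⊖⁺ ∘ r) (isRelation-⊖ (_⁻ ∘ r) (_⁺ ∘ r) (sym Σr⁺≡Σr⁻) (≈-sym r⁺≈r⁻))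

  isRelation-sub : ∀ {r s} → IsRelation r → IsRelation s → IsRelation (λ i → r i ℤ.- s i)
  isRelation-sub {r} {s} (Σr⁺≡Σr⁻ , r⁺≈r⁻) (Σs⁺≡Σs⁻ , s⁺≈s⁻) =
    isRelation-≗ (λ i → sym (sub≡⊖ (r i) (s i))) (isRelation-⊖ a b Σa≡Σb a≈b)
    where
    a = λ i → r i ⁺ + s i ⁻
    b = λ i → r i ⁻ + s i ⁺
    Σa≡Σb : sum a ≡ sum b
    Σa≡Σb = trans (∑-distrib-+ (_⁺ ∘ r) (_⁻ ∘ s))
              (trans (cong₂ _+_ Σr⁺≡Σr⁻ (sym Σs⁺≡Σs⁻)) (sym (∑-distrib-+ (_⁻ ∘ r) (_⁺ ∘ s))))
    a≈b : combination Γ x a ≈ combination Γ x b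
    a≈b = ≈-trans (combination-+ Γ x (_⁺ ∘ r) (_⁻ ∘ s))
            (≈-trans (∙-cong r⁺≈r⁻ (≈-sym s⁺≈s⁻)) (≈-sym (combination-+ Γ x (_⁻ ∘ r) (_⁺ ∘ s))))

  weight-neg : ∀ {r} → IsRelation r → weight (ℤ.-_ ∘ r) ≡ weight r
  weight-neg {r} (Σr⁺≡Σr⁻ , _) = trans (sum-cong-≗ (⁺-neg ∘ r)) (sym Σr⁺≡Σr⁻)

  -- The positive coefficients of r and s at X partly cancel in r - s.
  weight-sub< : ∀ {r s X} → 0ℤ ℤ.< r X → 0ℤ ℤ.< s X → IsRelation s →
                weight (λ i → r i ℤ.- s i) < weight r + weight s
  weight-sub< {r} {s} {X} 0<rX 0<sX (Σs⁺≡Σs⁻ , _) = begin-strict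
    weight (λ i → r i ℤ.- s i)    ≡⟨ sum-cong-≗ (λ i → trans (cong _⁺ (sub≡⊖ (r i) (s i))) (⁺-⊖ (a i) (b i))) ⟩
    sum (λ i → a i ∸ b i)         <⟨ sum-mono-< (λ i → ℕP.m∸n≤m (a i) (b i)) (m∸n<m 0<aX 0<bX) ⟩
    sum a                         ≡⟨ ∑-distrib-+ (_⁺ ∘ r) (_⁻ ∘ s) ⟩
    weight r + sum (_⁻ ∘ s)       ≡⟨ cong (_+_ (weight r)) Σs⁺≡Σs⁻ ⟨
    weight r + weight s           ∎
    where
    open ℕP.≤-Reasoning
    a = λ i → r i ⁺ + s i ⁻
    b = λ i → r i ⁻ + s i ⁺
    0<aX : 0 < a X
    0<aX = ℕP.<-≤-trans (0<⇒0<⁺ 0<rX) (ℕP.m≤m+n _ _)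
    0<bX : 0 < b X
    0<bX = ℕP.<-≤-trans (0<⇒0<⁺ 0<sX) (ℕP.m≤n+m _ _)

  0<weight : ∀ {r} → IsRelation r → Nontrivial r → 0 < weight r
  0<weight {r} (Σr⁺≡Σr⁻ , _) (i , r≢0) with ≢0⇒0<⁺⊎0<⁻ r≢0
  ... | inj₁ 0<r⁺ = ℕP.<-≤-trans 0<r⁺ (f≤sum[f] (_⁺ ∘ r) i)
  ... | inj₂ 0<r⁻ = subst (0 <_) (sym Σr⁺≡Σr⁻) (ℕP.<-≤-trans 0<r⁻ (f≤sum[f] (_⁻ ∘ r) i))

  ∃-negative-coefficient : ∀ {r} → IsRelation r → Nontrivial r → ∃ λ g → 0 < r g ⁻
  ∃-negative-coefficient {r} rel nontrivial =
    0<sum⇒∃0< (_⁻ ∘ r) (subst (0 <_) (proj₁ rel) (0<weight rel nontrivial))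

  IsShortRelation : ℕ → Pred (Fin n → ℤ) ℓ
  IsShortRelation h r = IsRelation r × Nontrivial r × weight r ≤ h

  module Short (h : ℕ) = CircuitExchange (IsShortRelation h) support

  WeightGap : ℕ → Set ℓ
  WeightGap h = ∀ {u} → IsRelation u → Nontrivial u → weight u < 2 * h → weight u ≤ h

  weightGap⇒circuitElimination : ∀ {h} → WeightGap h → Short.CircuitElimination h
  weightGap⇒circuitElimination {h} gap {u} {s} {X} {Y} (u-rel , _ , u≤h) (s-rel , _ , s≤h) X∈u X∈s Y∈u Y∉s =
    let t , (t-rel , t≤h , t⊆u∪s) , tX≡0 , tY≢0 =
          eliminate (u-rel , u≤h , p⊆p∪q (support s)) (s-rel , s≤h , q⊆p∪q (support u) (support s))
                    (∈-support⇒≢0 X∈u) (∈-support⇒≢0 X∈s) (∈-support⇒≢0 Y∈u) sY≡0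
    in t , (t-rel , (Y , tY≢0) , t≤h) , (λ X∈t → ∈-support⇒≢0 X∈t tX≡0) , t⊆u∪s
    where
    P : Pred (Fin n → ℤ) ℓ
    P t = IsRelation t × weight t ≤ h × support t ⊆ support u ∪ support s

    P-neg : ∀ {r} → P r → P (ℤ.-_ ∘ r)
    P-neg {r} (r-rel , r≤h , r⊆u∪s) =
      isRelation-neg r-rel , subst (_≤ h) (sym (weight-neg r-rel)) r≤h , r⊆u∪s ∘ support-neg r

    P-sub : ∀ {r r' X} → P r → P r' → 0ℤ ℤ.< r X → 0ℤ ℤ.< r' X →
            Nontrivial (λ i → r i ℤ.- r' i) → P (λ i → r i ℤ.- r' i)
    P-sub {r} {r'} (r-rel , r≤h , r⊆u∪s) (r'-rel , r'≤h , r'⊆u∪s) 0<rX 0<r'X nontrivial =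
      isRelation-sub r-rel r'-rel ,
      gap (isRelation-sub r-rel r'-rel) nontrivial
        (ℕP.<-≤-trans (weight-sub< {r} {r'} 0<rX 0<r'X r'-rel) r+r'≤2h) ,
      ∪-least r⊆u∪s r'⊆u∪s ∘ support-sub r r'
      where
      r+r'≤2h : weight r + weight r' ≤ 2 * h
      r+r'≤2h = subst (weight r + weight r' ≤_) (cong (_+_ h) (sym (ℕP.+-identityʳ h))) (ℕP.+-mono-≤ r≤h r'≤h)

    open Elimination P P-neg P-sub using (eliminate)

    sY≡0 : s Y ≡ 0ℤ
    sY≡0 = decidable-stable (s Y ℤ.≟ 0ℤ) (Y∉s ∘ ≢0⇒∈-support)

module BhSets {c ℓ : Level} (Γ : AbelianGroup c ℓ) {n : ℕ} (x : Fin n → AbelianGroup.Carrier Γ)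
  (x-injective : Injective _≡_ (AbelianGroup._≈_ Γ) x) where
  open AbelianGroup Γ using (Carrier; _≈_; _∙_; ∙-cong; reflexive)
    renaming (refl to ≈-refl; sym to ≈-sym; trans to ≈-trans)
  open Relations Γ x

  -- The matched positions of two padded tuples cannot lie in the first block:
  -- e and e' have disjoint images and g is not in the image of e.
  padding : ∀ {p} {A : Pred Carrier p} {m k k'} (e e' : Fin m → Fin n) (g : Fin n) →
            (∀ j j' → e j ≢ e' j') → (∀ j → e j ≢ g) →
            (∀ j → A (x (e j))) → (∀ j → A (x (e' j))) → A (x g) →
            ΣΓ Γ (x ∘ e) ≈ ΣΓ Γ (x ∘ e') → IsBhk Γ (m + k') k A → k ≤ k'
  padding {A = A} {m} {k} {k'} e e' g e≢e' e≢g A-e A-e' A-g Σe≈Σe' isBhk =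
    injection-into-↑ʳ⇒≤ σ σ-injective σ-into-↑ʳ
    where
    ι ι' : Fin (m + k') → Fin n
    ι  = e  ++ replicate k' g
    ι' = e' ++ replicate k' g

    A-ι : ∀ i → A (x (ι i))
    A-ι i with splitAt m i
    ... | inj₁ j = A-e j
    ... | inj₂ _ = A-g

    A-ι' : ∀ i → A (x (ι' i))
    A-ι' i with splitAt m i
    ... | inj₁ j = A-e' j
    ... | inj₂ _ = A-g

    Σ-padded : ∀ (f : Fin m → Fin n) →
               ΣΓ Γ (x ∘ (f ++ replicate k' g)) ≈ ΣΓ Γ (x ∘ f) ∙ ΣΓ Γ (replicate k' (x g))
    Σ-padded f =
      ≈-trans (ΣΓ-cong Γ (λ i → reflexive ([,]-∘ x (splitAt m i)))) (ΣΓ-++ Γ (x ∘ f) (replicate k' (x g)))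

    Σι≈Σι' : ΣΓ Γ (x ∘ ι) ≈ ΣΓ Γ (x ∘ ι')
    Σι≈Σι' = ≈-trans (Σ-padded e) (≈-trans (∙-cong Σe≈Σe' ≈-refl) (≈-sym (Σ-padded e')))

    matching = isBhk (x ∘ ι) (x ∘ ι') A-ι A-ι' Σι≈Σι'
    σ  = proj₁ matching
    σ' = proj₁ (proj₂ matching)
    σ-injective = proj₁ (proj₂ (proj₂ matching))

    ι'σ'≡ισ : ∀ j → ι' (σ' j) ≡ ι (σ j)
    ι'σ'≡ισ j = x-injective (proj₂ (proj₂ (proj₂ (proj₂ matching))) j)

    e≢ι' : ∀ l i → e l ≢ ι' i
    e≢ι' l i with splitAt m i
    ... | inj₁ j = e≢e' l j
    ... | inj₂ _ = e≢g l

    σ-into-↑ʳ : ∀ j → ∃ λ t → m Fin.↑ʳ t ≡ σ j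
    σ-into-↑ʳ j with splitAt m (σ j) in split
    ... | inj₂ t = t , FinP.splitAt⁻¹-↑ʳ split
    ... | inj₁ l = ⊥-elim (e≢ι' l (σ' j) (trans (cong [ e , replicate k' g ]′ (sym split)) (sym (ι'σ'≡ισ j))))

  relation-padding : ∀ {p} {A : Pred Carrier p} {u k k'} → IsRelation u → Nontrivial u →
                     (∀ {i} → i ∈ support u → A (x i)) → IsBhk Γ (weight u + k') k A → k ≤ k'
  relation-padding {A = A} {u = u} u-rel@(Σu⁺≡Σu⁻ , u⁺≈u⁻) nontrivial A-support =
    padding {A = A} e e' g e≢e' e≢g (A-nonzero ∘ 0<⁺⇒≢0 ∘ 0<u⁺[e]) (A-nonzero ∘ 0<⁻⇒≢0 ∘ 0<u⁻[e'])
      (A-nonzero (0<⁻⇒≢0 0<u⁻[g])) Σe≈Σe'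
    where
    e e' : Fin (weight u) → Fin n
    e  = enumerate (_⁺ ∘ u)
    e' = enumerate (_⁻ ∘ u) ∘ Fin.cast Σu⁺≡Σu⁻
    g = proj₁ (∃-negative-coefficient u-rel nontrivial)
    0<u⁻[g] = proj₂ (∃-negative-coefficient u-rel nontrivial)

    0<u⁺[e] : ∀ j → 0 < u (e j) ⁺
    0<u⁺[e] = 0<c[enumerate] (_⁺ ∘ u)
    0<u⁻[e'] : ∀ j → 0 < u (e' j) ⁻
    0<u⁻[e'] = 0<c[enumerate] (_⁻ ∘ u) ∘ Fin.cast Σu⁺≡Σu⁻

    A-nonzero : ∀ {i} → u i ≢ 0ℤ → A (x i)
    A-nonzero = A-support ∘ ≢0⇒∈-support

    e≢e' : ∀ j j' → e j ≢ e' j'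
    e≢e' j j' ej≡e'j' = 0<⁺⇒¬0<⁻ (0<u⁺[e] j) (subst (λ i → 0 < u i ⁻) (sym ej≡e'j') (0<u⁻[e'] j'))
    e≢g : ∀ j → e j ≢ g
    e≢g j ej≡g = 0<⁺⇒¬0<⁻ (0<u⁺[e] j) (subst (λ i → 0 < u i ⁻) (sym ej≡g) 0<u⁻[g])

    Σe≈Σe' : ΣΓ Γ (x ∘ e) ≈ ΣΓ Γ (x ∘ e')
    Σe≈Σe' = let open SetoidReasoning (AbelianGroup.setoid Γ) in begin
      ΣΓ Γ (x ∘ e)                         ≈⟨ combination-enumerate Γ x (_⁺ ∘ u) ⟩
      combination Γ x (_⁺ ∘ u)             ≈⟨ u⁺≈u⁻ ⟩
      combination Γ x (_⁻ ∘ u)             ≈⟨ combination-enumerate Γ x (_⁻ ∘ u) ⟨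
      ΣΓ Γ (x ∘ enumerate (_⁻ ∘ u))        ≈⟨ ΣΓ-cast Γ Σu⁺≡Σu⁻ (x ∘ enumerate (_⁻ ∘ u)) ⟨
      ΣΓ Γ (x ∘ e')                        ∎

  isBh⇒independent : ∀ {h J} → IsBh Γ h (Img Γ x J) → Short.Independent h J
  isBh⇒independent {h} {J} isBh {u} (u-rel , nontrivial , u≤h) u⊆J =
    ℕP.<-irrefl refl (begin-strict
      h               ≤⟨ relation-padding {A = Img Γ x J} u-rel nontrivial (λ i∈u → _ , u⊆J i∈u , ≈-refl) isBhk ⟩
      k'              <⟨ ℕP.m<n+m k' (0<weight u-rel nontrivial) ⟩
      weight u + k'   ≡⟨ w+k'≡h ⟩
      h               ∎)
    where
    open ℕP.≤-Reasoning
    k' = proj₁ (ℕP.m≤n⇒∃[o]m+o≡n u≤h)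
    w+k'≡h = proj₂ (ℕP.m≤n⇒∃[o]m+o≡n u≤h)
    isBhk = subst (λ l → IsBhk Γ l h (Img Γ x J)) (sym w+k'≡h) isBh

  independent⇒isBh : ∀ {h J} → Short.Independent h J → IsBh Γ h (Img Γ x J)
  independent⇒isBh {h} {J} independent a a' a∈J a'∈J Σa≈Σa' =
    id , σ , id , σ-injective ,
    λ j → ≈-trans (a'≈x[p'] (σ j)) (≈-trans (reflexive (cong x (p'σ≡p j))) (≈-sym (a≈x[p] j)))
    where
    p p' : Fin h → Fin n
    p  = proj₁ ∘ a∈J
    p' = proj₁ ∘ a'∈J
    a≈x[p]  = proj₂ ∘ proj₂ ∘ a∈J
    a'≈x[p'] = proj₂ ∘ proj₂ ∘ a'∈J

    μ μ' : Fin n → ℕ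
    μ  = multiplicity p
    μ' = multiplicity p'

    r : Fin n → ℤ
    r i = μ i ⊖ μ' i

    r-rel : IsRelation r
    r-rel = isRelation-⊖ μ μ' (trans (sum-multiplicity p) (sym (sum-multiplicity p')))
      (≈-trans (≈-sym (combination-multiplicity Γ x p))
        (≈-trans (ΣΓ-cong Γ (≈-sym ∘ a≈x[p]))
          (≈-trans Σa≈Σa' (≈-trans (ΣΓ-cong Γ a'≈x[p']) (combination-multiplicity Γ x p')))))

    r≤h : weight r ≤ h
    r≤h = ℕP.≤-trans (weight-⊖ μ μ') (ℕP.≤-reflexive (sum-multiplicity p))

    image⊆J : ∀ (q : Fin h → Fin n) → (∀ j → q j ∈ J) → ∀ {i} → 0 < multiplicity q i → i ∈ J
    image⊆J q q∈J {i} 0<mult = let j , qj≡i = 0<multiplicity⇒∈image q i 0<mult in subst (_∈ J) qj≡i (q∈J j)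

    r⊆J : support r ⊆ J
    r⊆J {i} i∈r with ≢0⇒0<⁺⊎0<⁻ (∈-support⇒≢0 i∈r)
    ... | inj₁ 0<r⁺ = image⊆J p  (proj₁ ∘ proj₂ ∘ a∈J)  (0<[m⊖n]⁺⇒0<m (μ i) (μ' i) 0<r⁺)
    ... | inj₂ 0<r⁻ = image⊆J p' (proj₁ ∘ proj₂ ∘ a'∈J) (0<[m⊖n]⁻⇒0<n (μ i) (μ' i) 0<r⁻)

    same : ∀ i → μ i ≡ μ' i
    same = decidable-stable (FinP.all? λ i → μ i ℕ.≟ μ' i) λ differ →
      let i , μi≢μ'i = FinP.¬∀⟶∃¬ n _ (λ i → μ i ℕ.≟ μ' i) differ
      in independent (r-rel , (i , μi≢μ'i ∘ m⊖n≡0⇒m≡n) , r≤h) r⊆J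

    σ = proj₁ (rearrangement p p' same)
    σ-injective = proj₁ (proj₂ (rearrangement p p' same))
    p'σ≡p = proj₂ (proj₂ (rearrangement p p' same))

  isMaximalBhSubset⇒isMaximalIndependent : ∀ {h S} → IsMaximalBhSubset Γ h x S → Short.IsMaximalIndependent h S
  isMaximalBhSubset⇒isMaximalIndependent (isBh , maximal) =
    isBh⇒independent isBh , λ J S⊆J independent → maximal J S⊆J (independent⇒isBh independent)

  isBhk⇒weightGap : ∀ {h} → IsBhk Γ (2 * h ∸ 1) (h ∸ 1) (Img Γ x ⊤) → WeightGap h
  isBhk⇒weightGap {zero}  _     _     _          ()
  isBhk⇒weightGap {suc h} isBhk {u} u-rel nontrivial u<2h = ℕP.+-cancelʳ-≤ h (weight u) (suc h) (begin
    weight u + h      ≤⟨ ℕP.+-monoʳ-≤ (weight u) h≤k' ⟩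
    weight u + k'     ≡⟨ w+k'≡2h-1 ⟩
    h + suc (h + 0)   ≡⟨ trans (ℕP.+-suc h (h + 0)) (cong (λ m → suc (h + m)) (ℕP.+-identityʳ h)) ⟩
    suc h + h         ∎)
    where
    open ℕP.≤-Reasoning
    k' = proj₁ (ℕP.m≤n⇒∃[o]m+o≡n (ℕP.≤-pred u<2h))
    w+k'≡2h-1 = proj₂ (ℕP.m≤n⇒∃[o]m+o≡n (ℕP.≤-pred u<2h))
    h≤k' : h ≤ k'
    h≤k' = relation-padding {A = Img Γ x ⊤} u-rel nontrivial (λ _ → _ , ∈⊤ , ≈-refl)
             (subst (λ l → IsBhk Γ l h (Img Γ x ⊤)) (sym w+k'≡2h-1) isBhk)

mainTheorem5 : ∀ {c ℓ : Level} (Γ : AbelianGroup c ℓ) (h : ℕ) → 2 ≤ h →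
    ∀ {n : ℕ} (x : Fin n → AbelianGroup.Carrier Γ) →
    Injective _≡_ (AbelianGroup._≈_ Γ) x →
    IsBhk Γ (2 * h ∸ 1) (h ∸ 1) (Img Γ x ⊤) →
    ∀ (S T : Subset n) →
    IsMaximalBhSubset Γ h x S → IsMaximalBhSubset Γ h x T →
    ∣ S ∣ ≡ ∣ T ∣
mainTheorem5 Γ h _ x x-injective isBhk S T maxS maxT =
  Short.maximal-independent-sets-equicardinal h circuitElimination
    (isMaximalBhSubset⇒isMaximalIndependent maxS) (isMaximalBhSubset⇒isMaximalIndependent maxT)
  where
  open Relations Γ x
  open BhSets Γ x x-injective
  circuitElimination = weightGap⇒circuitElimination (isBhk⇒weightGap isBhk)
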